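{- Let $n$ and $r$ be positive integers with $\frac{14}{5}r-1\le n\le 3r-2$. Then $\rho_2(n,r)=3$.
   Context: For integers $n\ge 2r\ge 2$, the Kneser graph $K(n,r)$ has as vertices the $r$-element subsets of $[n]=\{1,\dots,n\}$, two vertices being adjacent iff they are disjoint. A 2-packing of a graph is a set of vertices that are pairwise at distance at least $3$ (no two adjacent and no two with a common neighbor); $\rho_2(n,r)$ is the maximum cardinality of a 2-packing of $K(n,r)$. -}

module Defs where

open import Data.Nat using (ℕ; _≤_; _*_; _+_; suc)
open import Data.Fin.Subset using (Subset; ∣_∣; _∩_; Empty)
open import Data.List using (List; length)
open import Data.List.Relation.Unary.AllPairs using (AllPairs)
open import Data.Product using (Σ; _×_; ∃; _,_)
open import Relation.Binary.PropositionalEquality using (_≡_)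
open import Relation.Nullary using (¬_)

-- Vertices of the Kneser graph K(n,r): r-element subsets of [n] (modelled as Fin n).
Vertex : ℕ → ℕ → Set
Vertex n r = Σ (Subset n) (λ s → ∣ s ∣ ≡ r)

Adj : ∀ {n r} → Vertex n r → Vertex n r → Set
Adj (s , _) (t , _) = Empty (s ∩ t)

Far : ∀ {n r} → Vertex n r → Vertex n r → Set
Far {n} {r} u v =
  ¬ (u ≡ v) × ¬ Adj u v × ¬ (∃ λ (w : Vertex n r) → Adj u w × Adj v w)

-- A 2-packing, given as a list of vertices which are pairwise at distance ≥ 3
-- (in particular pairwise distinct, so the length is the cardinality).
Is2Packing : ∀ {n r} → List (Vertex n r) → Set
Is2Packing = AllPairs Far

Rho2≡ : ℕ → ℕ → ℕ → Set
Rho2≡ n r k =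
  (∃ λ (P : List (Vertex n r)) → Is2Packing P × length P ≡ k)
  × (∀ (P : List (Vertex n r)) → Is2Packing P → length P ≤ k)

-- Two r-sets s, t have a common neighbour in K(n,r) iff some r-set avoids s ∪ t, i.e. iff
-- r ≤ n − |s ∪ t|; with |s ∪ t| = 2r − |s ∩ t| they are therefore at distance ≥ 3 exactly when
-- 0 < |s ∩ t| < r and n + |s ∩ t| < 3r.  Summing the last inequality over the pairs of a
-- 2-packing of k vertices and comparing with the Bonferroni inequality kr ≤ n + Σ|s ∩ t| gives
-- kr + C(k,2)(n + 1) ≤ n + 3r C(k,2), which fails for k = 4 as soon as 14r ≤ 5(n + 1).
-- Conversely, write n = 3r − 1 − s; the hypotheses give s ≥ 1 and r ≥ 5s, so three r-sets
-- meeting pairwise in s points, with no point common to all three, fit into [n] and form a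
-- 2-packing.
module Submission where

open import Defs
open import Data.Nat using (ℕ; zero; suc; _+_; _*_; _≤_; _<_; _≰_; z≤n; s≤s)
open import Data.Nat.Properties
open import Algebra.Properties.CommutativeSemigroup +-commutativeSemigroup
  using () renaming (interchange to +-interchange)
open import Data.Nat.Combinatorics using (_C_; nC1≡n; nCk+nC[k+1]≡[n+1]C[k+1])
open import Data.Nat.Tactic.RingSolver using (solve-∀)
open import Data.Bool using (Bool; true; false; _∧_; if_then_else_)
open import Data.Vec using ([]; _∷_; replicate; _++_)
open import Data.Vec.Properties using (zipWith-++; zipWith-replicate)
open import Data.Fin.Subset using (Subset; ⊥; ∣_∣; _∩_; _∪_; ∁; ⋃; Empty; _⊆_; inside; outside)
open import Data.Fin.Subset.Properties
  using (x∈p∩q⁻; x∈p∩q⁺; x∈p∪q⁻; x∈∁p⇒x∉p; x∉p⇒x∈∁p; p⊆q⇒∣p∣≤∣q∣; p⊆q⇒∁p⊇∁q; p⊆p∪q; q⊆p∪q;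
         ∣p∣≤n; ⊥⊆; in⊆in; out⊆; ∣∁p∣≡n∸∣p∣; ∣⊥∣≡0; ∩-idem; ∩-zeroʳ; ∩-distribˡ-∪; Empty-unique)
open import Data.List using (List; []; _∷_; length; map; take)
open import Data.Nat.ListAction using (sum)
open import Data.List.Properties using (length-map)
open import Data.List.Relation.Unary.All using (All; []; _∷_)
import Data.List.Relation.Unary.AllPairs as AllPairs
open import Data.List.Relation.Unary.AllPairs using (AllPairs; []; _∷_)
open import Data.List.Relation.Unary.AllPairs.Properties using (map⁺; take⁺)
open import Data.Product using (_×_; ∃; ∃₂; _,_; proj₁)
open import Data.Sum using ([_,_])
open import Function using (id; _∘_; _⇔_; mk⇔; Equivalence)
open import Relation.Binary.PropositionalEquality
  using (_≡_; refl; sym; trans; cong; cong₂; subst; subst₂; module ≡-Reasoning)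
open import Relation.Nullary using (¬_; contradiction)

private variable
  n r : ℕ

∣p∪q∣+∣p∩q∣≡∣p∣+∣q∣ : ∀ (p q : Subset n) → ∣ p ∪ q ∣ + ∣ p ∩ q ∣ ≡ ∣ p ∣ + ∣ q ∣
∣p∪q∣+∣p∩q∣≡∣p∣+∣q∣ []            []            = refl
∣p∪q∣+∣p∩q∣≡∣p∣+∣q∣ (inside  ∷ p) (inside  ∷ q) =
  cong suc (trans (+-suc _ _) (trans (cong suc (∣p∪q∣+∣p∩q∣≡∣p∣+∣q∣ p q)) (sym (+-suc _ _))))
∣p∪q∣+∣p∩q∣≡∣p∣+∣q∣ (inside  ∷ p) (outside ∷ q) = cong suc (∣p∪q∣+∣p∩q∣≡∣p∣+∣q∣ p q)
∣p∪q∣+∣p∩q∣≡∣p∣+∣q∣ (outside ∷ p) (inside  ∷ q) =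
  trans (cong suc (∣p∪q∣+∣p∩q∣≡∣p∣+∣q∣ p q)) (sym (+-suc _ _))
∣p∪q∣+∣p∩q∣≡∣p∣+∣q∣ (outside ∷ p) (outside ∷ q) = ∣p∪q∣+∣p∩q∣≡∣p∣+∣q∣ p q

∣p∪q∣≤∣p∣+∣q∣ : ∀ (p q : Subset n) → ∣ p ∪ q ∣ ≤ ∣ p ∣ + ∣ q ∣
∣p∪q∣≤∣p∣+∣q∣ p q = ≤-trans (m≤m+n _ _) (≤-reflexive (∣p∪q∣+∣p∩q∣≡∣p∣+∣q∣ p q))

∣∁p∣+∣p∣≡n : ∀ (p : Subset n) → ∣ ∁ p ∣ + ∣ p ∣ ≡ n
∣∁p∣+∣p∣≡n p = trans (cong (_+ ∣ p ∣) (∣∁p∣≡n∸∣p∣ p)) (m∸n+n≡m (∣p∣≤n p))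

∣p++q∣≡∣p∣+∣q∣ : ∀ {m} (p : Subset m) (q : Subset n) → ∣ p ++ q ∣ ≡ ∣ p ∣ + ∣ q ∣
∣p++q∣≡∣p∣+∣q∣ []            q = refl
∣p++q∣≡∣p∣+∣q∣ (inside  ∷ p) q = cong suc (∣p++q∣≡∣p∣+∣q∣ p q)
∣p++q∣≡∣p∣+∣q∣ (outside ∷ p) q = ∣p++q∣≡∣p∣+∣q∣ p q

∣replicate∣ : ∀ k b → ∣ replicate k b ∣ ≡ (if b then k else 0)
∣replicate∣ zero    true  = refl
∣replicate∣ (suc k) true  = cong suc (∣replicate∣ k true)
∣replicate∣ zero    false = refl
∣replicate∣ (suc k) false = ∣replicate∣ k false

k≤∣p∣⇒∃[q⊆p]∣q∣≡k : ∀ (p : Subset n) k → k ≤ ∣ p ∣ → ∃ λ q → q ⊆ p × ∣ q ∣ ≡ k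
k≤∣p∣⇒∃[q⊆p]∣q∣≡k {n} p zero _ = ⊥ , ⊥⊆ , ∣⊥∣≡0 n
k≤∣p∣⇒∃[q⊆p]∣q∣≡k (inside ∷ p) (suc k) (s≤s k≤∣p∣) =
  let q , q⊆p , ∣q∣≡k = k≤∣p∣⇒∃[q⊆p]∣q∣≡k p k k≤∣p∣ in inside ∷ q , in⊆in q⊆p , cong suc ∣q∣≡k
k≤∣p∣⇒∃[q⊆p]∣q∣≡k (outside ∷ p) (suc k) k≤∣p∣ =
  let q , q⊆p , ∣q∣≡k = k≤∣p∣⇒∃[q⊆p]∣q∣≡k p (suc k) k≤∣p∣ in outside ∷ q , out⊆ q⊆p , ∣q∣≡k

disjoint⇒⊆∁∪ : ∀ {p q w : Subset n} → Empty (p ∩ w) → Empty (q ∩ w) → w ⊆ ∁ (p ∪ q)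
disjoint⇒⊆∁∪ {p = p} {q} {w} p∩w≡∅ q∩w≡∅ {x} x∈w = x∉p⇒x∈∁p
  ([ (λ x∈p → p∩w≡∅ (x , x∈p∩q⁺ (x∈p , x∈w))) , (λ x∈q → q∩w≡∅ (x , x∈p∩q⁺ (x∈q , x∈w))) ]
   ∘ x∈p∪q⁻ p q)

⊆∁⇒disjoint : ∀ {p w : Subset n} → w ⊆ ∁ p → Empty (p ∩ w)
⊆∁⇒disjoint {p = p} {w} w⊆∁p (x , x∈p∩w) =
  let x∈p , x∈w = x∈p∩q⁻ p w x∈p∩w in x∈∁p⇒x∉p (w⊆∁p x∈w) x∈p

pairSum : ∀ {a} {A : Set a} → (A → A → ℕ) → List A → ℕ
pairSum f []       = 0
pairSum f (x ∷ xs) = sum (map (f x) xs) + pairSum f xs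

overlaps : List (Subset n) → ℕ
overlaps = pairSum (λ p q → ∣ p ∩ q ∣)

∣p∩⋃qs∣≤∑∣p∩q∣ : ∀ (p : Subset n) qs → ∣ p ∩ ⋃ qs ∣ ≤ sum (map (λ q → ∣ p ∩ q ∣) qs)
∣p∩⋃qs∣≤∑∣p∩q∣ {n} p []       = ≤-reflexive (trans (cong ∣_∣ (∩-zeroʳ p)) (∣⊥∣≡0 n))
∣p∩⋃qs∣≤∑∣p∩q∣ p (q ∷ qs) = begin
  ∣ p ∩ (q ∪ ⋃ qs) ∣           ≡⟨ cong ∣_∣ (∩-distribˡ-∪ p q (⋃ qs)) ⟩
  ∣ (p ∩ q) ∪ (p ∩ ⋃ qs) ∣     ≤⟨ ∣p∪q∣≤∣p∣+∣q∣ (p ∩ q) (p ∩ ⋃ qs) ⟩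
  ∣ p ∩ q ∣ + ∣ p ∩ ⋃ qs ∣     ≤⟨ +-monoʳ-≤ ∣ p ∩ q ∣ (∣p∩⋃qs∣≤∑∣p∩q∣ p qs) ⟩
  sum (map (λ q → ∣ p ∩ q ∣) (q ∷ qs)) ∎
  where open ≤-Reasoning

∑∣p∣≤∣⋃ps∣+overlaps : ∀ (ps : List (Subset n)) → sum (map ∣_∣ ps) ≤ ∣ ⋃ ps ∣ + overlaps ps
∑∣p∣≤∣⋃ps∣+overlaps []       = z≤n
∑∣p∣≤∣⋃ps∣+overlaps (p ∷ ps) = begin
  ∣ p ∣ + sum (map ∣_∣ ps)                  ≤⟨ +-monoʳ-≤ ∣ p ∣ (∑∣p∣≤∣⋃ps∣+overlaps ps) ⟩
  ∣ p ∣ + (∣ ⋃ ps ∣ + overlaps ps)          ≡⟨ +-assoc ∣ p ∣ _ _ ⟨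
  ∣ p ∣ + ∣ ⋃ ps ∣ + overlaps ps            ≡⟨ cong (_+ overlaps ps) (∣p∪q∣+∣p∩q∣≡∣p∣+∣q∣ p (⋃ ps)) ⟨
  ∣ p ∪ ⋃ ps ∣ + ∣ p ∩ ⋃ ps ∣ + overlaps ps ≤⟨ +-monoˡ-≤ (overlaps ps) (+-monoʳ-≤ ∣ p ∪ ⋃ ps ∣ (∣p∩⋃qs∣≤∑∣p∩q∣ p ps)) ⟩
  ∣ p ∪ ⋃ ps ∣ + sum (map (λ q → ∣ p ∩ q ∣) ps) + overlaps ps ≡⟨ +-assoc ∣ p ∪ ⋃ ps ∣ _ _ ⟩
  ∣ ⋃ (p ∷ ps) ∣ + overlaps (p ∷ ps) ∎
  where open ≤-Reasoning

sum-map-const : ∀ {a} {A : Set a} m (xs : List A) → sum (map (λ _ → m) xs) ≡ length xs * m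
sum-map-const m []       = refl
sum-map-const m (x ∷ xs) = cong (m +_) (sum-map-const m xs)

sum-map-+ : ∀ {a} {A : Set a} (f g : A → ℕ) xs →
            sum (map (λ x → f x + g x) xs) ≡ sum (map f xs) + sum (map g xs)
sum-map-+ f g []       = refl
sum-map-+ f g (x ∷ xs) =
  trans (cong (f x + g x +_) (sum-map-+ f g xs)) (+-interchange (f x) (g x) _ _)

sum-map-mono : ∀ {a ℓ} {A : Set a} {P : A → Set ℓ} {f g : A → ℕ} {xs} →
               (∀ {x} → P x → f x ≤ g x) → All P xs → sum (map f xs) ≤ sum (map g xs)
sum-map-mono f≤g []         = z≤n
sum-map-mono f≤g (px ∷ pxs) = +-mono-≤ (f≤g px) (sum-map-mono f≤g pxs)

pairSum-const : ∀ {a} {A : Set a} m (xs : List A) → pairSum (λ _ _ → m) xs ≡ (length xs C 2) * m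
pairSum-const m []       = refl
pairSum-const m (x ∷ xs) = begin
  sum (map (λ _ → m) xs) + pairSum (λ _ _ → m) xs ≡⟨ cong₂ _+_ (sum-map-const m xs) (pairSum-const m xs) ⟩
  length xs * m + (length xs C 2) * m             ≡⟨ *-distribʳ-+ m (length xs) _ ⟨
  (length xs + length xs C 2) * m                 ≡⟨ cong (λ k → (k + length xs C 2) * m) (nC1≡n (length xs)) ⟨
  (length xs C 1 + length xs C 2) * m             ≡⟨ cong (_* m) (nCk+nC[k+1]≡[n+1]C[k+1] (length xs) 1) ⟩
  (suc (length xs) C 2) * m                       ∎
  where open ≡-Reasoning

pairSum-+ : ∀ {a} {A : Set a} (f g : A → A → ℕ) xs →
            pairSum (λ x y → f x y + g x y) xs ≡ pairSum f xs + pairSum g xs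
pairSum-+ f g []       = refl
pairSum-+ f g (x ∷ xs) =
  trans (cong₂ _+_ (sum-map-+ (f x) (g x) xs) (pairSum-+ f g xs))
        (+-interchange (sum (map (f x) xs)) (sum (map (g x) xs)) (pairSum f xs) (pairSum g xs))

pairSum-mono : ∀ {a ℓ} {A : Set a} {R : A → A → Set ℓ} {f g : A → A → ℕ} {xs} →
               (∀ {x y} → R x y → f x y ≤ g x y) → AllPairs R xs → pairSum f xs ≤ pairSum g xs
pairSum-mono f≤g []           = z≤n
pairSum-mono f≤g (rx ∷ rxs) = +-mono-≤ (sum-map-mono f≤g rx) (pairSum-mono f≤g rxs)

∣∁[s∪t]∣+2r≡n+∣s∩t∣ : ∀ (u v : Vertex n r) →
  ∣ ∁ (proj₁ u ∪ proj₁ v) ∣ + (r + r) ≡ n + ∣ proj₁ u ∩ proj₁ v ∣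
∣∁[s∪t]∣+2r≡n+∣s∩t∣ {n} {r} (s , ∣s∣≡r) (t , ∣t∣≡r) = begin
  ∣ ∁ (s ∪ t) ∣ + (r + r)                        ≡⟨ cong (∣ ∁ (s ∪ t) ∣ +_) (cong₂ _+_ ∣s∣≡r ∣t∣≡r) ⟨
  ∣ ∁ (s ∪ t) ∣ + (∣ s ∣ + ∣ t ∣)                ≡⟨ cong (∣ ∁ (s ∪ t) ∣ +_) (∣p∪q∣+∣p∩q∣≡∣p∣+∣q∣ s t) ⟨
  ∣ ∁ (s ∪ t) ∣ + (∣ s ∪ t ∣ + ∣ s ∩ t ∣)        ≡⟨ +-assoc ∣ ∁ (s ∪ t) ∣ _ _ ⟨
  ∣ ∁ (s ∪ t) ∣ + ∣ s ∪ t ∣ + ∣ s ∩ t ∣          ≡⟨ cong (_+ ∣ s ∩ t ∣) (∣∁p∣+∣p∣≡n (s ∪ t)) ⟩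
  n + ∣ s ∩ t ∣                                  ∎
  where open ≡-Reasoning

commonNeighbour⇔ : ∀ (u v : Vertex n r) →
  (∃ λ w → Adj u w × Adj v w) ⇔ r ≤ ∣ ∁ (proj₁ u ∪ proj₁ v) ∣
commonNeighbour⇔ {n} {r} u@(s , _) v@(t , _) = mk⇔ to from
  where
  to : (∃ λ w → Adj u w × Adj v w) → r ≤ ∣ ∁ (s ∪ t) ∣
  to ((w , ∣w∣≡r) , s∩w≡∅ , t∩w≡∅) =
    subst (_≤ ∣ ∁ (s ∪ t) ∣) ∣w∣≡r (p⊆q⇒∣p∣≤∣q∣ (disjoint⇒⊆∁∪ s∩w≡∅ t∩w≡∅))
  from : r ≤ ∣ ∁ (s ∪ t) ∣ → ∃ λ w → Adj u w × Adj v w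
  from r≤∣∁[s∪t]∣ =
    let w , w⊆∁[s∪t] , ∣w∣≡r = k≤∣p∣⇒∃[q⊆p]∣q∣≡k (∁ (s ∪ t)) r r≤∣∁[s∪t]∣ in
    (w , ∣w∣≡r) ,
    ⊆∁⇒disjoint (λ x∈w → p⊆q⇒∁p⊇∁q (p⊆p∪q t) (w⊆∁[s∪t] x∈w)) ,
    ⊆∁⇒disjoint (λ x∈w → p⊆q⇒∁p⊇∁q (q⊆p∪q s t) (w⊆∁[s∪t] x∈w))

noCommonNeighbour⇔ : ∀ (u v : Vertex n r) →
  (¬ ∃ λ w → Adj u w × Adj v w) ⇔ n + ∣ proj₁ u ∩ proj₁ v ∣ < 3 * r
noCommonNeighbour⇔ {n} {r} u v = mk⇔
  (λ ¬common → c<r⇒n+o<3r (≰⇒> (¬common ∘ Equivalence.from common⇔)))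
  (λ n+o<3r → <⇒≱ (n+o<3r⇒c<r n+o<3r) ∘ Equivalence.to common⇔)
  where
  c o : ℕ
  c = ∣ ∁ (proj₁ u ∪ proj₁ v) ∣
  o = ∣ proj₁ u ∩ proj₁ v ∣
  common⇔ : (∃ λ w → Adj u w × Adj v w) ⇔ r ≤ c
  common⇔ = commonNeighbour⇔ u v
  r+[r+r]≡3r : r + (r + r) ≡ 3 * r
  r+[r+r]≡3r = cong (λ k → r + (r + k)) (sym (+-identityʳ r))
  c+2r≡n+o : c + (r + r) ≡ n + o
  c+2r≡n+o = ∣∁[s∪t]∣+2r≡n+∣s∩t∣ u v
  c<r⇒n+o<3r : c < r → n + o < 3 * r
  c<r⇒n+o<3r c<r = subst₂ _<_ c+2r≡n+o r+[r+r]≡3r (+-monoˡ-< (r + r) c<r)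
  n+o<3r⇒c<r : n + o < 3 * r → c < r
  n+o<3r⇒c<r n+o<3r = +-cancelʳ-< (r + r) c r (subst₂ _<_ (sym c+2r≡n+o) (sym r+[r+r]≡3r) n+o<3r)

far⇒n+∣s∩t∣<3r : ∀ {u v : Vertex n r} → Far u v → n + ∣ proj₁ u ∩ proj₁ v ∣ < 3 * r
far⇒n+∣s∩t∣<3r {u = u} {v} (_ , _ , noCommonNeighbour) =
  Equivalence.to (noCommonNeighbour⇔ u v) noCommonNeighbour

∣s∩t∣-bounds⇒far : ∀ (u v : Vertex n r) → 0 < ∣ proj₁ u ∩ proj₁ v ∣ → ∣ proj₁ u ∩ proj₁ v ∣ < r →
  n + ∣ proj₁ u ∩ proj₁ v ∣ < 3 * r → Far u v
∣s∩t∣-bounds⇒far {n} u@(s , ∣s∣≡r) v@(t , _) 0<o o<r n+o<3r =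
  u≢v , ¬adj , Equivalence.from (noCommonNeighbour⇔ u v) n+o<3r
  where
  u≢v : ¬ u ≡ v
  u≢v refl = <-irrefl (trans (cong ∣_∣ (∩-idem s)) ∣s∣≡r) o<r
  ¬adj : ¬ Adj u v
  ¬adj s∩t≡∅ = <-irrefl (sym (trans (cong ∣_∣ (Empty-unique s∩t≡∅)) (∣⊥∣≡0 n))) 0<o

∑∣s∣≡length*r : ∀ (P : List (Vertex n r)) → sum (map ∣_∣ (map proj₁ P)) ≡ length P * r
∑∣s∣≡length*r []               = refl
∑∣s∣≡length*r ((_ , ∣s∣≡r) ∷ P) = cong₂ _+_ ∣s∣≡r (∑∣s∣≡length*r P)

2-packing-inequality : ∀ (P : List (Vertex n r)) → Is2Packing P →
  length P * r + (length P C 2) * suc n ≤ n + (length P C 2) * (3 * r)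
2-packing-inequality {n} {r} P packing = begin
  length P * r + k₂ * suc n                   ≡⟨ cong (_+ k₂ * suc n) (∑∣s∣≡length*r P) ⟨
  sum (map ∣_∣ ps) + k₂ * suc n               ≤⟨ +-monoˡ-≤ (k₂ * suc n) (∑∣s∣≤n+overlaps) ⟩
  n + overlaps ps + k₂ * suc n                ≡⟨ +-assoc n _ _ ⟩
  n + (overlaps ps + k₂ * suc n)              ≡⟨ cong (n +_) (+-comm (overlaps ps) _) ⟩
  n + (k₂ * suc n + overlaps ps)              ≡⟨ cong (n +_) pairSum[1+n+∣s∩t∣]≡ ⟨
  n + pairSum (λ s t → suc n + ∣ s ∩ t ∣) ps  ≤⟨ +-monoʳ-≤ n (pairSum-mono id far-pairs) ⟩
  n + pairSum (λ _ _ → 3 * r) ps              ≡⟨ cong (n +_) (pairSum-const (3 * r) ps) ⟩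
  n + (length ps C 2) * (3 * r)               ≡⟨ cong (λ k → n + (k C 2) * (3 * r)) (length-map proj₁ P) ⟩
  n + k₂ * (3 * r)                            ∎
  where
  open ≤-Reasoning
  ps : List (Subset n)
  ps = map proj₁ P
  k₂ : ℕ
  k₂ = length P C 2
  ∑∣s∣≤n+overlaps : sum (map ∣_∣ ps) ≤ n + overlaps ps
  ∑∣s∣≤n+overlaps = ≤-trans (∑∣p∣≤∣⋃ps∣+overlaps ps) (+-monoˡ-≤ (overlaps ps) (∣p∣≤n (⋃ ps)))
  far-pairs : AllPairs (λ s t → n + ∣ s ∩ t ∣ < 3 * r) ps
  far-pairs = map⁺ (AllPairs.map far⇒n+∣s∩t∣<3r packing)
  pairSum[1+n+∣s∩t∣]≡ : pairSum (λ s t → suc n + ∣ s ∩ t ∣) ps ≡ k₂ * suc n + overlaps ps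
  pairSum[1+n+∣s∩t∣]≡ = begin-equality
    pairSum (λ s t → suc n + ∣ s ∩ t ∣) ps           ≡⟨ pairSum-+ (λ _ _ → suc n) (λ s t → ∣ s ∩ t ∣) ps ⟩
    pairSum (λ _ _ → suc n) ps + overlaps ps         ≡⟨ cong (_+ overlaps ps) (pairSum-const (suc n) ps) ⟩
    (length ps C 2) * suc n + overlaps ps            ≡⟨ cong (λ k → (k C 2) * suc n + overlaps ps) (length-map proj₁ P) ⟩
    k₂ * suc n + overlaps ps                         ∎

4r+6[n+1]≰n+18r : 14 * r ≤ 5 * (n + 1) → 4 * r + 6 * suc n ≰ n + 6 * (3 * r)
4r+6[n+1]≰n+18r {r = r} {n = n} 14r≤5[n+1] 4r+6[n+1]≤n+18r =
  <-irrefl refl (≤-trans 5[n+1]<14r 14r≤5[n+1])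
  where
  lhs : ∀ n r → (n + 4 * r) + suc (5 * (n + 1)) ≡ 4 * r + 6 * suc n
  lhs = solve-∀
  rhs : ∀ n r → (n + 4 * r) + 14 * r ≡ n + 6 * (3 * r)
  rhs = solve-∀
  5[n+1]<14r : 5 * (n + 1) < 14 * r
  5[n+1]<14r = +-cancelˡ-≤ (n + 4 * r) _ _ (subst₂ _≤_ (sym (lhs n r)) (sym (rhs n r)) 4r+6[n+1]≤n+18r)

2-packing-length≤3 : 14 * r ≤ 5 * (n + 1) → ∀ (P : List (Vertex n r)) → Is2Packing P → length P ≤ 3
2-packing-length≤3 _ []                    _ = z≤n
2-packing-length≤3 _ (_ ∷ [])              _ = s≤s z≤n
2-packing-length≤3 _ (_ ∷ _ ∷ [])          _ = s≤s (s≤s z≤n)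
2-packing-length≤3 _ (_ ∷ _ ∷ _ ∷ [])      _ = s≤s (s≤s (s≤s z≤n))
2-packing-length≤3 {r = r} 14r≤5[n+1] P@(_ ∷ _ ∷ _ ∷ _ ∷ _) packing =
  contradiction (2-packing-inequality (take 4 P) (take⁺ 4 packing)) (4r+6[n+1]≰n+18r {r = r} 14r≤5[n+1])

Colour : Set
Colour = Bool × Bool × Bool

inA inB inC : Colour → Bool
inA (x , _ , _) = x
inB (_ , y , _) = y
inC (_ , _ , z) = z

-- A region (k , (x , y , z)) is a block of k points lying in A, B, C according to x, y, z.
Region : Set
Region = ℕ × Colour

size : List Region → ℕ
size []             = 0
size ((k , _) ∷ rs) = k + size rs

members : (Colour → Bool) → (rs : List Region) → Subset (size rs)
members f []             = []
members f ((k , c) ∷ rs) = replicate k (f c) ++ members f rs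

count : (Colour → Bool) → List Region → ℕ
count f []             = 0
count f ((k , c) ∷ rs) = (if f c then k else 0) + count f rs

∣members∣≡count : ∀ f rs → ∣ members f rs ∣ ≡ count f rs
∣members∣≡count f []             = refl
∣members∣≡count f ((k , c) ∷ rs) =
  trans (∣p++q∣≡∣p∣+∣q∣ (replicate k (f c)) (members f rs))
        (cong₂ _+_ (∣replicate∣ k (f c)) (∣members∣≡count f rs))

members-∩ : ∀ f g rs → members f rs ∩ members g rs ≡ members (λ c → f c ∧ g c) rs
members-∩ f g []             = refl
members-∩ f g ((k , c) ∷ rs) =
  trans (zipWith-++ _∧_ (replicate k (f c)) (members f rs) (replicate k (g c)) (members g rs))
        (cong₂ _++_ (zipWith-replicate _∧_ (f c) (g c)) (members-∩ f g rs))

-- With s = t + 1: A, B, C have a + 2s points each, any two share s points, no point lies in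
-- all three, and 2s − 1 further points lie in none.
venn : ℕ → ℕ → List Region
venn a t =
  (s , true , true , false) ∷ (s , true , false , true) ∷ (s , false , true , true) ∷
  (a , true , false , false) ∷ (a , false , true , false) ∷ (a , false , false , true) ∷
  (t + s , false , false , false) ∷ []
  where s = suc t

size-venn : ∀ a t → size (venn a t) ≡ 3 * a + 5 * t + 4
size-venn a t = expand a t
  where
  expand : ∀ a t → suc t + (suc t + (suc t + (a + (a + (a + (t + suc t + 0)))))) ≡ 3 * a + 5 * t + 4
  expand = solve-∀

vennVertex : ∀ a t f → count f (venn a t) ≡ a + 2 * suc t → Vertex (size (venn a t)) (a + 2 * suc t)
vennVertex a t f ∣f∣≡r = members f (venn a t) , trans (∣members∣≡count f (venn a t)) ∣f∣≡r

vennVertex-far : ∀ a t f g {∣f∣≡r ∣g∣≡r} → count (λ c → f c ∧ g c) (venn a t) ≡ suc t →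
  Far (vennVertex a t f ∣f∣≡r) (vennVertex a t g ∣g∣≡r)
vennVertex-far a t f g {∣f∣≡r} {∣g∣≡r} ∣f∧g∣≡1+t =
  ∣s∩t∣-bounds⇒far (vennVertex a t f ∣f∣≡r) (vennVertex a t g ∣g∣≡r)
    (subst (0 <_) (sym overlap≡1+t) (s≤s z≤n))
    (subst₂ _<_ (sym overlap≡1+t) (sym (r≡1+t+[1+t+a] a t)) (m<m+n (suc t) (s≤s z≤n)))
    (subst (λ o → size (venn a t) + o < 3 * (a + 2 * suc t)) (sym overlap≡1+t)
      (≤-reflexive (trans (cong (λ m → suc (m + suc t)) (size-venn a t)) (n+1+t≡3r a t))))
  where
  overlap≡1+t : ∣ members f (venn a t) ∩ members g (venn a t) ∣ ≡ suc t
  overlap≡1+t = trans (cong ∣_∣ (members-∩ f g (venn a t)))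
                      (trans (∣members∣≡count (λ c → f c ∧ g c) (venn a t)) ∣f∧g∣≡1+t)
  r≡1+t+[1+t+a] : ∀ a t → a + 2 * suc t ≡ suc t + suc (t + a)
  r≡1+t+[1+t+a] = solve-∀
  n+1+t≡3r : ∀ a t → suc (3 * a + 5 * t + 4 + suc t) ≡ 3 * (a + 2 * suc t)
  n+1+t≡3r = solve-∀

venn-packing : ∀ a t → n ≡ size (venn a t) → r ≡ a + 2 * suc t →
  ∃ λ (P : List (Vertex n r)) → Is2Packing P × length P ≡ 3
venn-packing a t refl refl =
  A ∷ B ∷ C ∷ [] ,
  ((vennVertex-far a t inA inB ∣pairwise∩∣ ∷ vennVertex-far a t inA inC ∣pairwise∩∣ ∷ []) ∷
   (vennVertex-far a t inB inC ∣pairwise∩∣ ∷ []) ∷ [] ∷ []) ,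
  refl
  where
  ∣venn-set∣ : suc t + (suc t + (a + 0)) ≡ a + 2 * suc t
  ∣venn-set∣ = expand a t
    where
    expand : ∀ a t → suc t + (suc t + (a + 0)) ≡ a + 2 * suc t
    expand = solve-∀
  A B C : Vertex (size (venn a t)) (a + 2 * suc t)
  A = vennVertex a t inA ∣venn-set∣
  B = vennVertex a t inB ∣venn-set∣
  C = vennVertex a t inC ∣venn-set∣
  ∣pairwise∩∣ : suc t + 0 ≡ suc t
  ∣pairwise∩∣ = +-identityʳ (suc t)

5[1+t]≤r : ∀ {n r t} → 14 * r ≤ 5 * (n + 1) → n + 2 + t ≡ 3 * r → 5 * suc t ≤ r
5[1+t]≤r {n} {r} {t} 14r≤5[n+1] n+2+t≡3r = +-cancelˡ-≤ (14 * r) _ _ (begin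
  14 * r + 5 * suc t       ≤⟨ +-monoˡ-≤ (5 * suc t) 14r≤5[n+1] ⟩
  5 * (n + 1) + 5 * suc t  ≡⟨ collect n t ⟩
  5 * (n + 2 + t)          ≡⟨ cong (5 *_) n+2+t≡3r ⟩
  5 * (3 * r)              ≡⟨ split r ⟩
  14 * r + r               ∎)
  where
  open ≤-Reasoning
  collect : ∀ n t → 5 * (n + 1) + 5 * suc t ≡ 5 * (n + 2 + t)
  collect = solve-∀
  split : ∀ r → 5 * (3 * r) ≡ 14 * r + r
  split = solve-∀

n+2+t≡3[2[1+t]+a]⇒ : ∀ {n t a} → n + 2 + t ≡ 3 * (2 * suc t + a) → n ≡ 3 * a + 5 * t + 4
n+2+t≡3[2[1+t]+a]⇒ {n} {t} {a} eq = +-cancelʳ-≡ (2 + t) n _ (begin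
  n + (2 + t)                ≡⟨ +-assoc n 2 t ⟨
  n + 2 + t                  ≡⟨ eq ⟩
  3 * (2 * suc t + a)        ≡⟨ expand t a ⟩
  3 * a + 5 * t + 4 + (2 + t) ∎)
  where
  open ≡-Reasoning
  expand : ∀ t a → 3 * (2 * suc t + a) ≡ 3 * a + 5 * t + 4 + (2 + t)
  expand = solve-∀

parameters : 14 * r ≤ 5 * (n + 1) → n + 2 ≤ 3 * r →
  ∃₂ λ a t → n ≡ 3 * a + 5 * t + 4 × r ≡ a + 2 * suc t
parameters 14r≤5[n+1] n+2≤3r =
  let t , n+2+t≡3r = m≤n⇒∃[o]m+o≡n n+2≤3r
      a , 2[1+t]+a≡r = m≤n⇒∃[o]m+o≡n (≤-trans (*-monoˡ-≤ (suc t) {2} {5} (s≤s (s≤s z≤n)))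
                                               (5[1+t]≤r 14r≤5[n+1] n+2+t≡3r))
  in a , t ,
     n+2+t≡3[2[1+t]+a]⇒ (trans n+2+t≡3r (cong (3 *_) (sym 2[1+t]+a≡r))) ,
     trans (sym 2[1+t]+a≡r) (+-comm (2 * suc t) a)

three-far-vertices : 14 * r ≤ 5 * (n + 1) → n + 2 ≤ 3 * r →
  ∃ λ (P : List (Vertex n r)) → Is2Packing P × length P ≡ 3
three-far-vertices 14r≤5[n+1] n+2≤3r =
  let a , t , n≡3a+5t+4 , r≡a+2[1+t] = parameters 14r≤5[n+1] n+2≤3r in
  venn-packing a t (trans n≡3a+5t+4 (sym (size-venn a t))) r≡a+2[1+t]

mainTheorem15 : (n r : ℕ) → 1 ≤ n → 1 ≤ r →
    14 * r ≤ 5 * (n + 1) → n + 2 ≤ 3 * r →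
    Rho2≡ n r 3
-- The hypotheses 1 ≤ n and 1 ≤ r follow from the other two.
mainTheorem15 n r _ _ 14r≤5[n+1] n+2≤3r =
  three-far-vertices 14r≤5[n+1] n+2≤3r , 2-packing-length≤3 14r≤5[n+1]
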